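{- Let $(P,\le,*)$ be a relatively pseudocomplemented poset satisfying the Ascending Chain Condition and define $T(x,y,z):=\operatorname{Max}L\big((x*y)*z,(z*y)*x\big)$ for all $x,y,z\in P$. Then $T$ is a Malcev operator, i.e. $T(x,x,z)=\{z\}$ and $T(x,z,z)=\{x\}$ for all $x,z\in P$.
   Context: For a poset $(P,\le)$ and $x,y\in P$, $L(x,y)=\{z\in P\mid z\le x,\ z\le y\}$, and for $A\subseteq P$, $\operatorname{Max}A$ is the set of maximal elements of $A$. A poset is relatively pseudocomplemented if for all $x,y\in P$ there exists a greatest element $z$ of $P$ such that every element of $L(x,z)$ is $\le y$; this $z$ is denoted $x*y$. A ternary operator $T\colon P^3\to 2^P$ is a Malcev operator if $T(x,x,z)=z$ and $T(x,z,z)=x$ for all $x,z$ (singletons identified with their elements). -}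

module Defs where

open import Level using (Level; _⊔_)
open import Data.Nat using (ℕ; suc) renaming (_≤_ to _≤ℕ_)
open import Data.Product using (Σ; _×_; ∃)
open import Relation.Binary.Bundles using (Poset)

module _ {c ℓ₁ ℓ₂ : Level} (P : Poset c ℓ₁ ℓ₂) where
  open Poset P renaming (Carrier to A)

  Subset : (ℓ : Level) → Set (c ⊔ Level.suc ℓ)
  Subset ℓ = A → Set ℓ

  L : A → A → Subset ℓ₂
  L x y z = (z ≤ x) × (z ≤ y)

  Max : ∀ {ℓ} → Subset ℓ → Subset (c ⊔ ℓ ⊔ ℓ₁ ⊔ ℓ₂)
  Max S z = S z × (∀ w → S w → z ≤ w → w ≈ z)

  Admissible : A → A → A → Set (c ⊔ ℓ₂)
  Admissible x y z = ∀ w → w ≤ x → w ≤ z → w ≤ y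

  IsRelPseudocomplement : (A → A → A) → Set (c ⊔ ℓ₂)
  IsRelPseudocomplement _*_ =
    ∀ x y → Admissible x y (x * y) × (∀ z → Admissible x y z → z ≤ (x * y))

  ACC : Set (c ⊔ ℓ₁ ⊔ ℓ₂)
  ACC = ∀ (f : ℕ → A) → (∀ n → f n ≤ f (suc n)) →
        ∃ λ n → ∀ m → n ≤ℕ m → f m ≈ f n

  T : (A → A → A) → A → A → A → Subset (c ⊔ ℓ₁ ⊔ ℓ₂)
  T _*_ x y z = Max (L ((x * y) * z) ((z * y) * x))

  IsSingleton : ∀ {ℓ} → Subset ℓ → A → Set (c ⊔ ℓ ⊔ ℓ₁)
  IsSingleton S a = ∀ w → (S w → w ≈ a) × (w ≈ a → S w)

{-# OPTIONS --safe #-}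
-- In a relatively pseudocomplemented poset x * x is the top element, so the elements below
-- (x * x) * z are exactly those below z; and z ≤ (z * x) * x by modus ponens. Hence z is the
-- greatest element of L((x * x) * z, (z * x) * x) and therefore its only maximal element.
-- The case T(x, z, z) is symmetric.
module Submission where

open import Defs
open import Level using (Level; _⊔_)
open import Data.Product using (_×_; _,_; proj₁; proj₂)
open import Relation.Binary.Bundles using (Poset)
open import Relation.Binary.Definitions using (_Respects_)

module _ {c ℓ₁ ℓ₂ : Level} (P : Poset c ℓ₁ ℓ₂) where
  open Poset P renaming (Carrier to A)

  IsGreatest : ∀ {ℓ} → Subset P ℓ → A → Set (ℓ ⊔ c ⊔ ℓ₂)
  IsGreatest S d = S d × (∀ w → S w → w ≤ d)

  L-resp-≈ : ∀ a b → L P a b Respects _≈_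
  L-resp-≈ a b w≈v (w≤a , w≤b) = ≤-respˡ-≈ w≈v w≤a , ≤-respˡ-≈ w≈v w≤b

  Max-singleton-greatest : ∀ {ℓ} {S : Subset P ℓ} {d} →
    S Respects _≈_ → IsGreatest S d → IsSingleton P (Max P S) d
  Max-singleton-greatest {S = S} {d} resp (Sd , d-greatest) w = maximal⇒≈ , ≈⇒maximal
    where
    maximal⇒≈ : Max P S w → w ≈ d
    maximal⇒≈ (Sw , w-maximal) = Eq.sym (w-maximal d Sd (d-greatest w Sw))

    ≈⇒maximal : w ≈ d → Max P S w
    ≈⇒maximal w≈d = resp (Eq.sym w≈d) Sd ,
      λ v Sv w≤v → antisym (≤-respʳ-≈ (Eq.sym w≈d) (d-greatest v Sv)) w≤v

  module RelPseudocomplement (_*_ : A → A → A) (rp : IsRelPseudocomplement P _*_) where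

    *-elim : ∀ {x y w} → w ≤ x → w ≤ x * y → w ≤ y
    *-elim {x} {y} {w} = proj₁ (rp x y) w

    *-intro : ∀ {x y z} → Admissible P x y z → z ≤ x * y
    *-intro {x} {y} {z} = proj₂ (rp x y) z

    ≤-*-refl : ∀ x w → w ≤ x * x
    ≤-*-refl x w = *-intro (λ v v≤x _ → v≤x)

    ≤-**-swap : ∀ x y → x ≤ (x * y) * y
    ≤-**-swap x y = *-intro (λ v v≤x*y v≤x → *-elim v≤x v≤x*y)

    ≤-*-refl-* : ∀ x z → z ≤ (x * x) * z
    ≤-*-refl-* x z = *-intro (λ v _ v≤z → v≤z)

    *-refl-*-≤ : ∀ {x z w} → w ≤ (x * x) * z → w ≤ z
    *-refl-*-≤ {x} {w = w} = *-elim (≤-*-refl x w)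

lemma4p5 : ∀ {c ℓ₁ ℓ₂ : Level} (P : Poset c ℓ₁ ℓ₂) (_*_ : Poset.Carrier P → Poset.Carrier P → Poset.Carrier P) →
    IsRelPseudocomplement P _*_ → ACC P →
    ∀ x z → IsSingleton P (T P _*_ x x z) z × IsSingleton P (T P _*_ x z z) x
lemma4p5 P _*_ rp _ x z =
  Max-singleton-greatest P (L-resp-≈ P _ _) z-greatest ,
  Max-singleton-greatest P (L-resp-≈ P _ _) x-greatest
  where
  open RelPseudocomplement P _*_ rp

  z-greatest : IsGreatest P (L P ((x * x) * z) ((z * x) * x)) z
  z-greatest = (≤-*-refl-* x z , ≤-**-swap z x) , λ _ (w≤xx*z , _) → *-refl-*-≤ w≤xx*z

  x-greatest : IsGreatest P (L P ((x * z) * z) ((z * z) * x)) x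
  x-greatest = (≤-**-swap x z , ≤-*-refl-* z x) , λ _ (_ , w≤zz*x) → *-refl-*-≤ w≤zz*x
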